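{- For every $n\ge1$, the pairs of statistics $(\mathrm{mmp}^{(1,0,\emptyset,0)},\mathrm{mmp}^{(0,0,1,0)})$ and $(\mathrm{mmp}^{(0,0,1,0)},\mathrm{mmp}^{(1,0,\emptyset,0)})$ have the same joint distribution on $S_n(132)$; that is, for all $p,q$, the number of $\sigma\in S_n(132)$ with $\mathrm{mmp}^{(1,0,\emptyset,0)}(\sigma)=p$ and $\mathrm{mmp}^{(0,0,1,0)}(\sigma)=q$ equals the number of $\sigma\in S_n(132)$ with $\mathrm{mmp}^{(0,0,1,0)}(\sigma)=p$ and $\mathrm{mmp}^{(1,0,\emptyset,0)}(\sigma)=q$.
   Context: For $\sigma=\sigma_1\cdots\sigma_n\in S_n$: $\mathrm{mmp}^{(1,0,\emptyset,0)}(\sigma)$ is the number of positions $i$ such that some $j>i$ has $\sigma_j>\sigma_i$ and no $j<i$ has $\sigma_j<\sigma_i$; $\mathrm{mmp}^{(0,0,1,0)}(\sigma)$ is the number of positions $i$ such that some $j<i$ has $\sigma_j<\sigma_i$. $S_n(132)$ is the set of 132-avoiding permutations of $[n]$. -}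

module Defs where

open import Data.Nat using (ℕ; zero; suc; _<ᵇ_; _≡ᵇ_)
open import Data.Bool using (Bool; true; false; _∧_; _∨_; not)
open import Data.List using (List; []; _∷_; length; map; concatMap; filterᵇ; upTo)
open import Data.Bool.ListAction using (any; all)

-- A permutation σ = σ₁⋯σₙ of [n] = {1,…,n} is represented by its one-line
-- notation: the list [σ₁, …, σₙ] of natural numbers.

words : ℕ → ℕ → List (List ℕ)
words n zero    = [] ∷ []
words n (suc k) = concatMap (λ a → map (a ∷_) (words n k)) (map suc (upTo n))

-- the list contains each value 1,…,n (with length n this means it is a permutation)
isPerm : ℕ → List ℕ → Bool
isPerm n w = all (λ v → any (λ x → x ≡ᵇ v) w) (map suc (upTo n))

Sym : ℕ → List (List ℕ)
Sym n = filterᵇ (isPerm n) (words n n)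

positions : List ℕ → List ℕ
positions w = upTo (length w)

-- safe-ish lookup by ℕ index (default 0 outside the range; only used in range)
at : List ℕ → ℕ → ℕ
at []       _       = 0
at (x ∷ _)  zero    = x
at (_ ∷ xs) (suc i) = at xs i

contains132 : List ℕ → Bool
contains132 w =
  any (λ i → any (λ j → any (λ k →
        (i <ᵇ j) ∧ (j <ᵇ k) ∧ (at w i <ᵇ at w k) ∧ (at w k <ᵇ at w j))
      (positions w)) (positions w)) (positions w)

avoids132 : List ℕ → Bool
avoids132 w = not (contains132 w)

Sym132 : ℕ → List (List ℕ)
Sym132 n = filterᵇ avoids132 (Sym n)

count : {A : Set} → (A → Bool) → List A → ℕ
count p xs = length (filterᵇ p xs)

mmpA-at : List ℕ → ℕ → Bool
mmpA-at w i =
  any (λ j → (i <ᵇ j) ∧ (at w i <ᵇ at w j)) (positions w)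
  ∧ not (any (λ j → (j <ᵇ i) ∧ (at w j <ᵇ at w i)) (positions w))

mmpB-at : List ℕ → ℕ → Bool
mmpB-at w i = any (λ j → (j <ᵇ i) ∧ (at w j <ᵇ at w i)) (positions w)

mmp1000 : List ℕ → ℕ
mmp1000 w = count (mmpA-at w) (positions w)

mmp0010 : List ℕ → ℕ
mmp0010 w = count (mmpB-at w) (positions w)

-- A 132-avoiding permutation splits at its maximum M as α ++ M ∷ β, where every entry of β
-- is below every entry of α (otherwise a, M, b would form a 132) and α, β avoid 132 again.
-- Iterating identifies S_n(132) with binary trees on n nodes (encode / decode below).  On
-- such a layered word the two statistics satisfy
--   mmp0010 (α ++ M ∷ β) = mmp0010 α + [α nonempty] + mmp0010 β,
--   mmp1000 (α ++ M ∷ β) = (|α| ∸ mmp0010 α) + mmp1000 β,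
-- which become tree statistics stat0010 and stat1000.  From the identity
-- stat0010 t + [t nonempty] + stat0010 (mirror t) = size t, the tree involution
-- twist (node l r) = node (mirror l) (twist r) exchanges the two statistics.  Transported
-- to permutations it yields an involution Φ of S_n(132) swapping mmp1000 and mmp0010, and
-- a count over a duplicate-free list is unchanged when transported along an involution.

module Submission where

open import Defs
open import Data.Nat using (ℕ; zero; suc; _+_; _∸_; _≤_; _<_; _≥_; z≤n; s≤s; z<s; s<s; _<ᵇ_; _≡ᵇ_)
open import Data.Nat.Properties
open import Data.Bool using (Bool; true; false; _∧_; not; T; if_then_else_)
open import Data.Bool.Properties using (T-∧)
open import Data.Bool.ListAction using (any; all)
open import Data.List using (List; []; _∷_; length; map; filterᵇ; _++_; upTo; applyUpTo; concatMap; cartesianProductWith)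
open import Data.List.Properties using (length-++; length-applyUpTo; filter-++; map-upTo)
open import Data.List.Relation.Unary.Any using (here; there)
import Data.List.Relation.Unary.All as All
open All using (All; [])
import Data.List.Relation.Unary.All.Properties as AllProps
open import Data.List.Relation.Unary.AllPairs using ([]; _∷_)
open import Data.List.Relation.Unary.Unique.Propositional using (Unique)
open import Data.List.Relation.Unary.Unique.Propositional.Properties
  using (Unique[x∷xs]⇒x∉xs; filter⁺; ++⁺; applyUpTo⁺₁; cartesianProductWith⁺)
open import Data.List.Relation.Binary.Subset.Propositional using (_⊆_)
open import Data.List.Relation.Binary.Permutation.Propositional using (_↭_; ↭-sym; ↭⇒↭ₛ)
open import Data.List.Relation.Binary.Permutation.Propositional.Properties using (↭-length; filter-↭; shift; ∈-resp-↭)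
import Data.List.Relation.Binary.Permutation.Setoid.Properties as PermutationSetoid
open import Data.List.Relation.Binary.BagAndSetEquality using (∼bag⇒↭)
open import Data.List.Membership.Propositional using (_∈_; _∉_; find; lose)
open import Data.List.Membership.DecPropositional _≟_ using (_∈?_)
open import Data.List.Membership.Propositional.Properties
  using (∈-∃++; ∈-++⁺ˡ; ∈-++⁺ʳ; ∈-++⁻; ∈-map⁺; ∈-map⁻; ∈-upTo⁺; ∈-upTo⁻; ∈-applyUpTo⁺; ∈-applyUpTo⁻;
         ∈-cartesianProductWith⁺; ∈-cartesianProductWith⁻; ∈-filter⁺; ∈-filter⁻)
open import Data.List.Membership.Propositional.Properties.WithK using (unique∧set⇒bag)
open import Data.List.Relation.Unary.Any.Properties using (any⁺; any⁻)
open import Data.Product using (∃-syntax; _×_; _,_; proj₁; proj₂; uncurry)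
open import Data.Sum using (_⊎_; inj₁; inj₂)
open import Data.Empty using (⊥; ⊥-elim)
open import Data.Unit using (tt)
open import Function using (_∘_; id; mk⇔; Equivalence)
open import Relation.Binary.PropositionalEquality
open import Relation.Nullary using (¬_; yes; no)
open import Relation.Nullary.Decidable using (T?)
open import Data.Nat.Tactic.RingSolver using (solve-∀)

T-ext : {a b : Bool} → (T a → T b) → (T b → T a) → a ≡ b
T-ext {false} {false} _ _ = refl
T-ext {false} {true}  _ g = ⊥-elim (g tt)
T-ext {true}  {false} f _ = ⊥-elim (f tt)
T-ext {true}  {true}  _ _ = refl

∧-intro : {a b : Bool} → T a → T b → T (a ∧ b)
∧-intro ta tb = Equivalence.from T-∧ (ta , tb)

∧-elim : {a b : Bool} → T (a ∧ b) → T a × T b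
∧-elim = Equivalence.to T-∧

not-intro : {a : Bool} → ¬ T a → T (not a)
not-intro {false} _ = tt
not-intro {true}  f = f tt

not-elim : {a : Bool} → T (not a) → ¬ T a
not-elim {false} _ ()
not-elim {true}  ()

any-upTo⁺ : (f : ℕ → Bool) {n j : ℕ} → j < n → T (f j) → T (any f (upTo n))
any-upTo⁺ f j<n fj = any⁺ f (lose (∈-upTo⁺ j<n) fj)

any-upTo⁻ : (f : ℕ → Bool) (n : ℕ) → T (any f (upTo n)) → ∃[ j ] j < n × T (f j)
any-upTo⁻ f n t with j , j∈ , fj ← find (any⁻ f (upTo n) t) = j , ∈-upTo⁻ j∈ , fj

ind : Bool → ℕ
ind b = if b then 1 else 0

ind-true : ∀ {b} → T b → ind b ≡ 1
ind-true {true} _ = refl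

ind-false : ∀ {b} → ¬ T b → ind b ≡ 0
ind-false {false} _ = refl
ind-false {true}  f = ⊥-elim (f tt)

sgn : ℕ → ℕ
sgn zero    = 0
sgn (suc _) = 1

module _ {A : Set} where

  count-∷ : (p : A → Bool) (x : A) (xs : List A) → count p (x ∷ xs) ≡ ind (p x) + count p xs
  count-∷ p x xs with p x
  ... | true  = refl
  ... | false = refl

  count-++ : (p : A → Bool) (xs ys : List A) → count p (xs ++ ys) ≡ count p xs + count p ys
  count-++ p xs ys = trans (cong length (filter-++ (T? ∘ p) xs ys)) (length-++ (filterᵇ p xs))

  count-map : (p : A → Bool) (g : A → A) (xs : List A) → count p (map g xs) ≡ count (p ∘ g) xs
  count-map p g []       = refl
  count-map p g (x ∷ xs) = trans (count-∷ p (g x) (map g xs))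
    (trans (cong (ind (p (g x)) +_) (count-map p g xs)) (sym (count-∷ (p ∘ g) x xs)))

  count-cong : (p q : A → Bool) {xs : List A} → (∀ {x} → x ∈ xs → p x ≡ q x) → count p xs ≡ count q xs
  count-cong p q {[]}     _  = refl
  count-cong p q {x ∷ xs} eq = trans (count-∷ p x xs)
    (trans (cong₂ (λ b n → ind b + n) (eq (here refl)) (count-cong p q (eq ∘ there))) (sym (count-∷ q x xs)))

  count-not : (p : A → Bool) (xs : List A) → count (not ∘ p) xs ≡ length xs ∸ count p xs
  count-not p xs = trans (sym (m+n∸n≡m (count (not ∘ p) xs) (count p xs))) (cong (_∸ count p xs) (split xs))
    where
    split : (ys : List A) → count (not ∘ p) ys + count p ys ≡ length ys
    split []       = refl
    split (y ∷ ys) with p y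
    ... | true  = trans (+-suc _ _) (cong suc (split ys))
    ... | false = cong suc (split ys)

  count-↭ : (p : A → Bool) {xs ys : List A} → xs ↭ ys → count p xs ≡ count p ys
  count-↭ p π = ↭-length (filter-↭ (T? ∘ p) π)

module _ {A : Set} where

  unique-resp-↭ : {xs ys : List A} → xs ↭ ys → Unique xs → Unique ys
  unique-resp-↭ π = PermutationSetoid.Unique-resp-↭ (setoid A) (↭⇒↭ₛ π)

  unique-∷ : {x : A} {xs : List A} → x ∉ xs → Unique xs → Unique (x ∷ xs)
  unique-∷ x∉ u = AllProps.¬Any⇒All¬ _ x∉ ∷ u

  unique-++⁻ : ∀ (xs : List A) {ys} → Unique (xs ++ ys) → Unique xs × Unique ys × (∀ {z} → z ∈ xs → z ∉ ys)
  unique-++⁻ []       u          = [] , u , λ ()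
  unique-++⁻ (x ∷ xs) (x∉ ∷ u) with ux , uy , disj ← unique-++⁻ xs u =
    AllProps.++⁻ˡ xs x∉ ∷ ux , uy ,
    λ { (here refl) z∈ → All.lookup (AllProps.++⁻ʳ xs x∉) z∈ refl ; (there z∈) → disj z∈ }

  ∈⇒↭∷ : {x : A} {ys : List A} → x ∈ ys → ∃[ ys′ ] ys ↭ x ∷ ys′
  ∈⇒↭∷ {x} x∈ with ys₁ , ys₂ , refl ← ∈-∃++ x∈ = ys₁ ++ ys₂ , shift x ys₁ ys₂

  map-unique : (g : A → A) {xs : List A} → (∀ {x y} → x ∈ xs → y ∈ xs → g x ≡ g y → x ≡ y) →
               Unique xs → Unique (map g xs)
  map-unique g {[]}     _   _          = []
  map-unique g {x ∷ xs} inj (x∉ ∷ u) =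
    AllProps.map⁺ (All.tabulate (λ y∈ gx≡gy → All.lookup x∉ y∈ (inj (here refl) (there y∈) gx≡gy)))
    ∷ map-unique g (λ a b → inj (there a) (there b)) u

  ⊆-drop : {x : A} {xs ys ys′ : List A} → All (x ≢_) xs → ys ↭ x ∷ ys′ → xs ⊆ ys → xs ⊆ ys′
  ⊆-drop x∉ π sub z∈ with ∈-resp-↭ π (sub z∈)
  ... | here refl = ⊥-elim (All.lookup x∉ z∈ refl)
  ... | there z∈′ = z∈′

  unique-⊆⇒length≤ : {xs ys : List A} → Unique xs → xs ⊆ ys → length xs ≤ length ys
  unique-⊆⇒length≤ {[]}     _          _   = z≤n
  unique-⊆⇒length≤ {x ∷ xs} (x∉ ∷ u) sub with ys′ , π ← ∈⇒↭∷ (sub (here refl)) =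
    ≤-trans (s≤s (unique-⊆⇒length≤ u (⊆-drop x∉ π (sub ∘ there)))) (≤-reflexive (sym (↭-length π)))

  covering-unique : {xs ys : List A} → Unique xs → xs ⊆ ys → length ys ≤ length xs → Unique ys × ys ⊆ xs
  covering-unique {[]}     {[]}    _ _ _ = [] , λ ()
  covering-unique {[]}     {_ ∷ _} _ _ ()
  covering-unique {x ∷ xs} (x∉ ∷ u) sub len
    with ys′ , π ← ∈⇒↭∷ (sub (here refl))
    with uys′ , ys′⊆xs ← covering-unique u (⊆-drop x∉ π (sub ∘ there))
                                           (≤-pred (subst (_≤ length (x ∷ xs)) (↭-length π) len)) =
    unique-resp-↭ (↭-sym π) (unique-∷ (λ x∈ → All.lookup x∉ (ys′⊆xs x∈) refl) uys′) , back
    where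
    back : _ ⊆ x ∷ xs
    back z∈ with ∈-resp-↭ π z∈
    ... | here refl = here refl
    ... | there z∈′ = there (ys′⊆xs z∈′)

  count-involution : (p : A → Bool) (g : A → A) {xs : List A} → Unique xs →
                     (∀ {x} → x ∈ xs → g x ∈ xs) → (∀ {x} → x ∈ xs → g (g x) ≡ x) →
                     count p xs ≡ count (p ∘ g) xs
  count-involution p g {xs} u closed invol =
    trans (count-↭ p (∼bag⇒↭ (unique∧set⇒bag u u-gxs (mk⇔ into onto)))) (count-map p g xs)
    where
    u-gxs : Unique (map g xs)
    u-gxs = map-unique g (λ x∈ y∈ e → trans (sym (invol x∈)) (trans (cong g e) (invol y∈))) u
    into : xs ⊆ map g xs
    into x∈ = subst (_∈ map g xs) (invol x∈) (∈-map⁺ g (closed x∈))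
    onto : map g xs ⊆ xs
    onto y∈ with x , x∈ , refl ← ∈-map⁻ g y∈ = closed x∈

at-++ˡ : ∀ xs {ys i} → i < length xs → at (xs ++ ys) i ≡ at xs i
at-++ˡ (x ∷ xs) {ys} {zero}  _       = refl
at-++ˡ (x ∷ xs) {ys} {suc i} (s≤s l) = at-++ˡ xs l

at-++ʳ : ∀ xs {ys} i → at (xs ++ ys) (length xs + i) ≡ at ys i
at-++ʳ []       i = refl
at-++ʳ (x ∷ xs) i = at-++ʳ xs i

at-∈ : ∀ xs {i} → i < length xs → at xs i ∈ xs
at-∈ (x ∷ xs) {zero}  _       = here refl
at-∈ (x ∷ xs) {suc i} (s≤s l) = there (at-∈ xs l)

∈⇒at : ∀ {x} xs → x ∈ xs → ∃[ i ] i < length xs × at xs i ≡ x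
∈⇒at (y ∷ xs) (here refl) = 0 , z<s , refl
∈⇒at (y ∷ xs) (there x∈) with i , l , e ← ∈⇒at xs x∈ = suc i , s<s l , e

data Region (a b j : ℕ) : Set where
  inLeft  : j < a → Region a b j
  atMid   : j ≡ a → Region a b j
  inRight : ∀ k → k < b → j ≡ a + suc k → Region a b j

region : ∀ a b j → j < a + suc b → Region a b j
region zero    b zero    _       = atMid refl
region zero    b (suc j) (s≤s l) = inRight j l refl
region (suc a) b zero    _       = inLeft z<s
region (suc a) b (suc j) (s≤s l) with region a b j l
... | inLeft j<a          = inLeft (s<s j<a)
... | atMid refl          = atMid refl
... | inRight k k<b refl  = inRight k k<b refl

a<a+suc : ∀ a k → a < a + suc k
a<a+suc a k = m<m+n a z<s

+suc-mono : ∀ a {x y} → x < y → a + suc x < a + suc y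
+suc-mono a l = +-monoʳ-< a (s<s l)

+suc-cancel : ∀ a {x y} → a + suc x < a + suc y → x < y
+suc-cancel a {x} {y} h = ≤-pred (+-cancelˡ-< a (suc x) (suc y) h)

data Contains132 (w : List ℕ) : Set where
  occurrence : ∀ i j k → i < j → j < k → k < length w →
               at w i < at w k → at w k < at w j → Contains132 w

SmallerBefore : List ℕ → ℕ → Set
SmallerBefore w i = ∃[ j ] j < i × at w j < at w i

LargerAfter : List ℕ → ℕ → Set
LargerAfter w i = ∃[ j ] j < length w × i < j × at w i < at w j

module _ (w : List ℕ) where
  private
    pattern132 : ℕ → ℕ → ℕ → Bool
    pattern132 i j k = (i <ᵇ j) ∧ (j <ᵇ k) ∧ (at w i <ᵇ at w k) ∧ (at w k <ᵇ at w j)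
    n : ℕ
    n = length w

  contains132⇒ : T (contains132 w) → Contains132 w
  contains132⇒ t
    with i , i<n , t₁ ← any-upTo⁻ _ n t
    with j , j<n , t₂ ← any-upTo⁻ _ n t₁
    with k , k<n , t₃ ← any-upTo⁻ (pattern132 i j) n t₂
    with ij , t₄ ← ∧-elim t₃
    with jk , t₅ ← ∧-elim t₄
    with ik , kj ← ∧-elim t₅
    = occurrence i j k (<ᵇ⇒< i j ij) (<ᵇ⇒< j k jk) k<n (<ᵇ⇒< _ _ ik) (<ᵇ⇒< _ _ kj)

  contains132⇐ : Contains132 w → T (contains132 w)
  contains132⇐ (occurrence i j k ij jk k<n ik kj) =
    any-upTo⁺ _ (<-trans ij j<n) (any-upTo⁺ _ j<n (any-upTo⁺ (pattern132 i j) k<n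
      (∧-intro (<⇒<ᵇ ij) (∧-intro (<⇒<ᵇ jk) (∧-intro (<⇒<ᵇ ik) (<⇒<ᵇ kj))))))
    where
    j<n : j < n
    j<n = <-trans jk k<n

  avoids132⇒ : T (avoids132 w) → ¬ Contains132 w
  avoids132⇒ t c = not-elim t (contains132⇐ c)

  avoids132⇐ : ¬ Contains132 w → T (avoids132 w)
  avoids132⇐ f = not-intro (f ∘ contains132⇒)

  mmpB-at⇒ : ∀ {i} → T (mmpB-at w i) → SmallerBefore w i
  mmpB-at⇒ t with j , _ , t′ ← any-upTo⁻ _ n t with ji , v ← ∧-elim t′ = j , <ᵇ⇒< _ _ ji , <ᵇ⇒< _ _ v

  mmpB-at⇐ : ∀ {i} → i < n → SmallerBefore w i → T (mmpB-at w i)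
  mmpB-at⇐ i<n (j , ji , v) = any-upTo⁺ _ (<-trans ji i<n) (∧-intro (<⇒<ᵇ ji) (<⇒<ᵇ v))

  mmpA-at⇒ : ∀ {i} → i < n → T (mmpA-at w i) → LargerAfter w i × ¬ SmallerBefore w i
  mmpA-at⇒ i<n t with tL , tS ← ∧-elim t with j , j<n , t′ ← any-upTo⁻ _ n tL with ij , v ← ∧-elim t′ =
    (j , j<n , <ᵇ⇒< _ _ ij , <ᵇ⇒< _ _ v) , λ s → not-elim tS (mmpB-at⇐ i<n s)

  mmpA-at⇐ : ∀ {i} → LargerAfter w i → ¬ SmallerBefore w i → T (mmpA-at w i)
  mmpA-at⇐ (j , j<n , ij , v) ns =
    ∧-intro (any-upTo⁺ _ j<n (∧-intro (<⇒<ᵇ ij) (<⇒<ᵇ v))) (not-intro (ns ∘ mmpB-at⇒))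

applyUpTo-+ : {A : Set} (f : ℕ → A) (m n : ℕ) → applyUpTo f (m + n) ≡ applyUpTo f m ++ applyUpTo (λ i → f (m + i)) n
applyUpTo-+ f zero    n = refl
applyUpTo-+ f (suc m) n = cong (f 0 ∷_) (applyUpTo-+ (f ∘ suc) m n)

count-upTo-cong : (f g : ℕ → Bool) (n : ℕ) → (∀ i → i < n → f i ≡ g i) → count f (upTo n) ≡ count g (upTo n)
count-upTo-cong f g n eq = count-cong f g (λ i∈ → eq _ (∈-upTo⁻ i∈))

count-upTo-split : (f : ℕ → Bool) (a b : ℕ) →
  count f (upTo (a + suc b)) ≡ count f (upTo a) + (ind (f a) + count (λ k → f (a + suc k)) (upTo b))
count-upTo-split f a b = begin
  count f (upTo (a + suc b))
    ≡⟨ cong (count f) (applyUpTo-+ id a (suc b)) ⟩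
  count f (upTo a ++ (a + 0) ∷ applyUpTo (λ k → a + suc k) b)
    ≡⟨ count-++ f (upTo a) _ ⟩
  count f (upTo a) + count f ((a + 0) ∷ applyUpTo (λ k → a + suc k) b)
    ≡⟨ cong (count f (upTo a) +_) (count-∷ f (a + 0) _) ⟩
  count f (upTo a) + (ind (f (a + 0)) + count f (applyUpTo (λ k → a + suc k) b))
    ≡⟨ cong₂ (λ x y → count f (upTo a) + (ind (f x) + y)) (+-identityʳ a)
         (trans (cong (count f) (sym (map-upTo (λ k → a + suc k) b))) (count-map f (λ k → a + suc k) (upTo b))) ⟩
  count f (upTo a) + (ind (f a) + count (λ k → f (a + suc k)) (upTo b)) ∎
  where open ≡-Reasoning

module Concat (α β : List ℕ) (M : ℕ) where
  w : List ℕ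
  w = α ++ M ∷ β

  a b : ℕ
  a = length α
  b = length β

  length-w : length w ≡ a + suc b
  length-w = length-++ α

  at-left : ∀ {i} → i < a → at w i ≡ at α i
  at-left = at-++ˡ α

  at-mid : at w a ≡ M
  at-mid = trans (cong (at w) (sym (+-identityʳ a))) (at-++ʳ α 0)

  at-right : ∀ k → at w (a + suc k) ≡ at β k
  at-right k = at-++ʳ α (suc k)

  region-w : ∀ j → j < length w → Region a b j
  region-w j l = region a b j (subst (j <_) length-w l)

  left<w : ∀ {i} → i < a → i < length w
  left<w {i} l = subst (i <_) (sym length-w) (<-≤-trans l (m≤m+n a (suc b)))

  mid<w : a < length w
  mid<w = subst (a <_) (sym length-w) (a<a+suc a b)

  right<w : ∀ {k} → k < b → a + suc k < length w
  right<w l = subst (_ <_) (sym length-w) (+suc-mono a l)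

  contains132-left : Contains132 α → Contains132 w
  contains132-left (occurrence i j k ij jk k<a ik kj) =
    occurrence i j k ij jk (left<w k<a)
      (subst₂ _<_ (sym (at-left (<-trans ij j<a))) (sym (at-left k<a)) ik)
      (subst₂ _<_ (sym (at-left k<a)) (sym (at-left j<a)) kj)
    where
    j<a : j < a
    j<a = <-trans jk k<a

  contains132-right : Contains132 β → Contains132 w
  contains132-right (occurrence i j k ij jk k<b ik kj) =
    occurrence (a + suc i) (a + suc j) (a + suc k) (+suc-mono a ij) (+suc-mono a jk) (right<w k<b)
      (subst₂ _<_ (sym (at-right i)) (sym (at-right k)) ik)
      (subst₂ _<_ (sym (at-right k)) (sym (at-right j)) kj)

  contains132-across : ∀ i k → i < a → k < b → at α i < at β k → at β k < M → Contains132 w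
  contains132-across i k i<a k<b ik kM =
    occurrence i a (a + suc k) i<a (a<a+suc a k) (right<w k<b)
      (subst₂ _<_ (sym (at-left i<a)) (sym (at-right k)) ik)
      (subst₂ _<_ (sym (at-right k)) (sym at-mid) kM)

  -- The layered situation: M exceeds every other entry, and every entry of β is below
  -- every entry of α.  This is the shape of a 132-avoiding permutation around its maximum.
  module Layered (α<M : ∀ i → i < a → at α i < M) (β<M : ∀ k → k < b → at β k < M)
                 (β<α : ∀ i k → i < a → k < b → at β k < at α i) where

    avoids : ¬ Contains132 α → ¬ Contains132 β → ¬ Contains132 w
    avoids nα nβ (occurrence i j k ij jk k<w ik kj) with region-w k k<w
    ... | inLeft k<a = nα (occurrence i j k ij jk k<a
            (subst₂ _<_ (at-left (<-trans ij j<a)) (at-left k<a) ik)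
            (subst₂ _<_ (at-left k<a) (at-left j<a) kj))
      where
      j<a : j < a
      j<a = <-trans jk k<a
    ... | atMid refl = <-asym (α<M j jk) (subst₂ _<_ at-mid (at-left jk) kj)
    ... | inRight k′ k′<b refl with region-w j (<-trans jk k<w)
    ...   | inLeft j<a = <-asym (β<α i k′ (<-trans ij j<a) k′<b)
                                (subst₂ _<_ (at-left (<-trans ij j<a)) (at-right k′) ik)
    ...   | atMid refl = <-asym (β<α i k′ ij k′<b) (subst₂ _<_ (at-left ij) (at-right k′) ik)
    ...   | inRight j′ j′<b refl with region-w i (<-trans ij (<-trans jk k<w))
    ...     | inLeft i<a = <-asym (β<α i k′ i<a k′<b) (subst₂ _<_ (at-left i<a) (at-right k′) ik)
    ...     | atMid refl = <-asym (β<M k′ k′<b) (subst₂ _<_ at-mid (at-right k′) ik)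
    ...     | inRight i′ _ refl = nβ (occurrence i′ j′ k′ (+suc-cancel a ij) (+suc-cancel a jk) k′<b
                (subst₂ _<_ (at-right i′) (at-right k′) ik) (subst₂ _<_ (at-right k′) (at-right j′) kj))

    smaller-left⇒ : ∀ {i} → i < a → SmallerBefore w i → SmallerBefore α i
    smaller-left⇒ i<a (j , ji , v) = j , ji , subst₂ _<_ (at-left (<-trans ji i<a)) (at-left i<a) v

    smaller-left⇐ : ∀ {i} → i < a → SmallerBefore α i → SmallerBefore w i
    smaller-left⇐ i<a (j , ji , v) = j , ji , subst₂ _<_ (sym (at-left (<-trans ji i<a))) (sym (at-left i<a)) v

    -- Right part: entries of α and M are larger than every entry of β, so only β matters.
    smaller-right⇒ : ∀ {k} → k < b → SmallerBefore w (a + suc k) → SmallerBefore β k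
    smaller-right⇒ {k} k<b (j , ji , v) with region a b j (<-trans ji (+suc-mono a k<b))
    ... | inLeft j<a       = ⊥-elim (<-asym (β<α j k j<a k<b) (subst₂ _<_ (at-left j<a) (at-right k) v))
    ... | atMid refl       = ⊥-elim (<-asym (β<M k k<b) (subst₂ _<_ at-mid (at-right k) v))
    ... | inRight j′ _ refl = j′ , +suc-cancel a ji , subst₂ _<_ (at-right j′) (at-right k) v

    smaller-right⇐ : ∀ {k} → SmallerBefore β k → SmallerBefore w (a + suc k)
    smaller-right⇐ {k} (j , jk , v) = a + suc j , +suc-mono a jk , subst₂ _<_ (sym (at-right j)) (sym (at-right k)) v

    mmpB-left : ∀ i → i < a → mmpB-at w i ≡ mmpB-at α i
    mmpB-left i i<a = T-ext (λ t → mmpB-at⇐ α i<a (smaller-left⇒ i<a (mmpB-at⇒ w t)))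
                            (λ t → mmpB-at⇐ w (left<w i<a) (smaller-left⇐ i<a (mmpB-at⇒ α t)))

    mmpB-mid : ind (mmpB-at w a) ≡ sgn a
    mmpB-mid = by-length a refl
      where
      by-length : ∀ n → a ≡ n → ind (mmpB-at w a) ≡ sgn n
      by-length zero    a≡0 = ind-false λ t → let (j , j<a , _) = mmpB-at⇒ w t in n≮0 (subst (j <_) a≡0 j<a)
      by-length (suc _) a≡n = ind-true (mmpB-at⇐ w mid<w
        (0 , 0<a , subst₂ _<_ (sym (at-left 0<a)) (sym at-mid) (α<M 0 0<a)))
        where 0<a = subst (0 <_) (sym a≡n) z<s

    mmpB-right : ∀ k → k < b → mmpB-at w (a + suc k) ≡ mmpB-at β k
    mmpB-right k k<b = T-ext (λ t → mmpB-at⇐ β k<b (smaller-right⇒ k<b (mmpB-at⇒ w t)))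
                             (λ t → mmpB-at⇐ w (right<w k<b) (smaller-right⇐ (mmpB-at⇒ β t)))

    -- every entry of α has the larger entry M after it
    mmpA-left : ∀ i → i < a → mmpA-at w i ≡ not (mmpB-at α i)
    mmpA-left i i<a = T-ext
      (λ t → not-intro (λ s → proj₂ (mmpA-at⇒ w (left<w i<a) t) (smaller-left⇐ i<a (mmpB-at⇒ α s))))
      (λ t → mmpA-at⇐ w (a , mid<w , i<a , subst₂ _<_ (sym (at-left i<a)) (sym at-mid) (α<M i i<a))
                        (λ s → not-elim t (mmpB-at⇐ α i<a (smaller-left⇒ i<a s))))

    -- nothing after M is larger than M
    mmpA-mid : mmpA-at w a ≡ false
    mmpA-mid = T-ext noLarger λ ()
      where
      noLarger : T (mmpA-at w a) → T false
      noLarger t with (j , j<w , a<j , v) , _ ← mmpA-at⇒ w mid<w t with region-w j j<w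
      ... | inLeft j<a        = <-asym a<j j<a
      ... | atMid refl        = <-irrefl refl a<j
      ... | inRight j′ j′<b refl = <-asym (β<M j′ j′<b) (subst₂ _<_ at-mid (at-right j′) v)

    mmpA-right : ∀ k → k < b → mmpA-at w (a + suc k) ≡ mmpA-at β k
    mmpA-right k k<b = T-ext toβ fromβ
      where
      toβ : T (mmpA-at w (a + suc k)) → T (mmpA-at β k)
      toβ t with (j , j<w , kj , v) , ns ← mmpA-at⇒ w (right<w k<b) t with region-w j j<w
      ... | inLeft j<a           = ⊥-elim (<-asym (a<a+suc a k) (<-trans kj j<a))
      ... | atMid refl           = ⊥-elim (<-asym (a<a+suc a k) kj)
      ... | inRight j′ j′<b refl =
        mmpA-at⇐ β (j′ , j′<b , +suc-cancel a kj , subst₂ _<_ (at-right k) (at-right j′) v) (ns ∘ smaller-right⇐)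
      fromβ : T (mmpA-at β k) → T (mmpA-at w (a + suc k))
      fromβ t with (j , j<b , kj , v) , ns ← mmpA-at⇒ β k<b t =
        mmpA-at⇐ w (a + suc j , right<w j<b , +suc-mono a kj , subst₂ _<_ (sym (at-right k)) (sym (at-right j)) v)
                   (ns ∘ smaller-right⇒ k<b)

    mmp0010-layered : mmp0010 w ≡ mmp0010 α + (sgn a + mmp0010 β)
    mmp0010-layered = begin
      count (mmpB-at w) (upTo (length w))
        ≡⟨ cong (λ n → count (mmpB-at w) (upTo n)) length-w ⟩
      count (mmpB-at w) (upTo (a + suc b))
        ≡⟨ count-upTo-split (mmpB-at w) a b ⟩
      count (mmpB-at w) (upTo a) + (ind (mmpB-at w a) + count (λ k → mmpB-at w (a + suc k)) (upTo b))
        ≡⟨ cong₂ _+_ (count-upTo-cong _ _ a mmpB-left)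
             (cong₂ _+_ mmpB-mid (count-upTo-cong _ _ b mmpB-right)) ⟩
      mmp0010 α + (sgn a + mmp0010 β) ∎
      where open ≡-Reasoning

    mmp1000-layered : mmp1000 w ≡ (a ∸ mmp0010 α) + mmp1000 β
    mmp1000-layered = begin
      count (mmpA-at w) (upTo (length w))
        ≡⟨ cong (λ n → count (mmpA-at w) (upTo n)) length-w ⟩
      count (mmpA-at w) (upTo (a + suc b))
        ≡⟨ count-upTo-split (mmpA-at w) a b ⟩
      count (mmpA-at w) (upTo a) + (ind (mmpA-at w a) + count (λ k → mmpA-at w (a + suc k)) (upTo b))
        ≡⟨ cong₂ _+_ (count-upTo-cong _ _ a mmpA-left)
             (cong₂ _+_ (cong ind mmpA-mid) (count-upTo-cong _ _ b mmpA-right)) ⟩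
      count (not ∘ mmpB-at α) (upTo a) + mmp1000 β
        ≡⟨ cong (_+ mmp1000 β) (trans (count-not (mmpB-at α) (upTo a))
                                      (cong (_∸ mmp0010 α) (length-applyUpTo id a))) ⟩
      (a ∸ mmp0010 α) + mmp1000 β ∎
      where open ≡-Reasoning

-- Binary trees and the statistics-swapping involution.

data Tree : Set where
  leaf : Tree
  node : Tree → Tree → Tree

size : Tree → ℕ
size leaf       = 0
size (node l r) = suc (size l + size r)

-- Tree versions of mmp^(0,0,1,0) and mmp^(1,0,∅,0), following the recursions
-- mmp0010-layered and mmp1000-layered (the tree node l r stands for α ++ M ∷ β).
stat0010 : Tree → ℕ
stat0010 leaf       = 0
stat0010 (node l r) = stat0010 l + (sgn (size l) + stat0010 r)

stat1000 : Tree → ℕ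
stat1000 leaf       = 0
stat1000 (node l r) = (size l ∸ stat0010 l) + stat1000 r

mirror : Tree → Tree
mirror leaf       = leaf
mirror (node l r) = node (mirror r) (mirror l)

-- the involution exchanging the two statistics
twist : Tree → Tree
twist leaf       = leaf
twist (node l r) = node (mirror l) (twist r)

size-mirror : ∀ t → size (mirror t) ≡ size t
size-mirror leaf       = refl
size-mirror (node l r) = cong suc (trans (cong₂ _+_ (size-mirror r) (size-mirror l)) (+-comm (size r) (size l)))

mirror-involutive : ∀ t → mirror (mirror t) ≡ t
mirror-involutive leaf       = refl
mirror-involutive (node l r) = cong₂ node (mirror-involutive l) (mirror-involutive r)

size-twist : ∀ t → size (twist t) ≡ size t
size-twist leaf       = refl
size-twist (node l r) = cong suc (cong₂ _+_ (size-mirror l) (size-twist r))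

twist-involutive : ∀ t → twist (twist t) ≡ t
twist-involutive leaf       = refl
twist-involutive (node l r) = cong₂ node (mirror-involutive l) (twist-involutive r)

stat0010-mirror : ∀ t → (stat0010 t + sgn (size t)) + stat0010 (mirror t) ≡ size t
stat0010-mirror leaf       = refl
stat0010-mirror (node l r) = begin
  stat0010 l + (sgn (size l) + stat0010 r) + 1 + (stat0010 (mirror r) + (sgn (size (mirror r)) + stat0010 (mirror l)))
    ≡⟨ cong (λ s → stat0010 l + (sgn (size l) + stat0010 r) + 1 + (stat0010 (mirror r) + (sgn s + stat0010 (mirror l))))
            (size-mirror r) ⟩
  stat0010 l + (sgn (size l) + stat0010 r) + 1 + (stat0010 (mirror r) + (sgn (size r) + stat0010 (mirror l)))
    ≡⟨ regroup (stat0010 l) (stat0010 (mirror l)) (stat0010 r) (stat0010 (mirror r)) (sgn (size l)) (sgn (size r)) ⟩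
  suc ((stat0010 l + sgn (size l) + stat0010 (mirror l)) + (stat0010 r + sgn (size r) + stat0010 (mirror r)))
    ≡⟨ cong₂ (λ x y → suc (x + y)) (stat0010-mirror l) (stat0010-mirror r) ⟩
  suc (size l + size r) ∎
  where
  open ≡-Reasoning
  regroup : ∀ x x′ y y′ s s′ → (x + (s + y) + 1) + (y′ + (s′ + x′)) ≡ suc ((x + s + x′) + (y + s′ + y′))
  regroup = solve-∀

stat1000-twist : ∀ t → stat1000 (twist t) ≡ stat0010 t
stat1000-twist leaf       = refl
stat1000-twist (node l r) = begin
  (size (mirror l) ∸ stat0010 (mirror l)) + stat1000 (twist r)
    ≡⟨ cong₂ (λ s x → (s ∸ stat0010 (mirror l)) + x) (size-mirror l) (stat1000-twist r) ⟩
  (size l ∸ stat0010 (mirror l)) + stat0010 r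
    ≡⟨ cong (λ s → (s ∸ stat0010 (mirror l)) + stat0010 r) (sym (stat0010-mirror l)) ⟩
  ((stat0010 l + sgn (size l)) + stat0010 (mirror l) ∸ stat0010 (mirror l)) + stat0010 r
    ≡⟨ cong (_+ stat0010 r) (m+n∸n≡m (stat0010 l + sgn (size l)) (stat0010 (mirror l))) ⟩
  (stat0010 l + sgn (size l)) + stat0010 r
    ≡⟨ +-assoc (stat0010 l) (sgn (size l)) (stat0010 r) ⟩
  stat0010 l + (sgn (size l) + stat0010 r) ∎
  where open ≡-Reasoning

stat0010-twist : ∀ t → stat0010 (twist t) ≡ stat1000 t
stat0010-twist leaf       = refl
stat0010-twist (node l r) = begin
  stat0010 (mirror l) + (sgn (size (mirror l)) + stat0010 (twist r))
    ≡⟨ cong₂ (λ s x → stat0010 (mirror l) + (sgn s + x)) (size-mirror l) (stat0010-twist r) ⟩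
  stat0010 (mirror l) + (sgn (size l) + stat1000 r)
    ≡⟨ sym (+-assoc (stat0010 (mirror l)) (sgn (size l)) (stat1000 r)) ⟩
  (stat0010 (mirror l) + sgn (size l)) + stat1000 r
    ≡⟨ cong (_+ stat1000 r) (sym (m+n∸m≡n (stat0010 l) (stat0010 (mirror l) + sgn (size l)))) ⟩
  (stat0010 l + (stat0010 (mirror l) + sgn (size l)) ∸ stat0010 l) + stat1000 r
    ≡⟨ cong (λ s → (s ∸ stat0010 l) + stat1000 r) (complement l) ⟩
  (size l ∸ stat0010 l) + stat1000 r ∎
  where
  open ≡-Reasoning
  complement : ∀ t → stat0010 t + (stat0010 (mirror t) + sgn (size t)) ≡ size t
  complement t = trans (cong (stat0010 t +_) (+-comm (stat0010 (mirror t)) (sgn (size t))))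
                       (trans (sym (+-assoc (stat0010 t) _ _)) (stat0010-mirror t))

-- Encoding a tree as a 132-avoiding permutation.

-- encode c t is a permutation of c+1, …, c+|t|: the root carries the maximum, the
-- left subtree the next |l| values, and the right subtree the |r| smallest values.
encode : ℕ → Tree → List ℕ
encode c leaf       = []
encode c (node l r) = encode (c + size r) l ++ (c + size (node l r)) ∷ encode c r

length-encode : ∀ c t → length (encode c t) ≡ size t
length-encode c leaf       = refl
length-encode c (node l r) = trans (length-++ (encode (c + size r) l))
  (trans (cong₂ (λ x y → x + suc y) (length-encode (c + size r) l) (length-encode c r)) (+-suc (size l) (size r)))

below-root-left : ∀ c l r {x} → x ≤ c + size r + size l → x < c + size (node l r)
below-root-left c l r {x} h =
  subst (x <_) (sym (+-suc c (size l + size r))) (s≤s (subst (x ≤_) (reassoc c (size l) (size r)) h))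
  where
  reassoc : ∀ c l r → c + r + l ≡ c + (l + r)
  reassoc = solve-∀

below-root-right : ∀ c l r {x} → x ≤ c + size r → x < c + size (node l r)
below-root-right c l r h = below-root-left c l r (≤-trans h (m≤m+n _ (size l)))

encode-bounds : ∀ c t {x} → x ∈ encode c t → c < x × x ≤ c + size t
encode-bounds c (node l r) {x} x∈ with ∈-++⁻ (encode (c + size r) l) x∈
... | inj₁ x∈l = let (lo , hi) = encode-bounds (c + size r) l x∈l in
                 ≤-<-trans (m≤m+n c (size r)) lo , <⇒≤ (below-root-left c l r hi)
... | inj₂ (here refl) = a<a+suc c (size l + size r) , ≤-refl
... | inj₂ (there x∈r) = let (lo , hi) = encode-bounds c r x∈r in lo , <⇒≤ (below-root-right c l r hi)

encode-covers : ∀ c t {x} → c < x → x ≤ c + size t → x ∈ encode c t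
encode-covers c leaf {x} c<x x≤c = ⊥-elim (<⇒≱ c<x (subst (x ≤_) (+-identityʳ c) x≤c))
encode-covers c (node l r) {x} c<x x≤ with x ≤? c + size r | x ≟ c + size (node l r)
... | yes x≤r | _    = ∈-++⁺ʳ (encode (c + size r) l) (there (encode-covers c r c<x x≤r))
... | no  _   | yes refl = ∈-++⁺ʳ (encode (c + size r) l) (here refl)
... | no  x≰r | no x≢M = ∈-++⁺ˡ (encode-covers (c + size r) l (≰⇒> x≰r) x≤l)
  where
  x≤l : x ≤ c + size r + size l
  x≤l = subst (x ≤_) (reassoc c (size l) (size r))
          (≤-pred (subst (x <_) (+-suc c (size l + size r)) (≤∧≢⇒< x≤ x≢M)))
    where
    reassoc : ∀ c l r → c + (l + r) ≡ c + r + l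
    reassoc = solve-∀

encode-unique : ∀ c t → Unique (encode c t)
encode-unique c leaf       = []
encode-unique c (node l r) =
  ++⁺ (encode-unique (c + size r) l) (unique-∷ M∉r (encode-unique c r)) disjoint
  where
  M = c + size (node l r)
  M∉r : M ∉ encode c r
  M∉r M∈ = <-irrefl refl (below-root-right c l r (proj₂ (encode-bounds c r M∈)))
  disjoint : ∀ {z} → z ∈ encode (c + size r) l × z ∈ M ∷ encode c r → ⊥
  disjoint (z∈l , here refl)  = <-irrefl refl (below-root-left c l r (proj₂ (encode-bounds (c + size r) l z∈l)))
  disjoint (z∈l , there z∈r) =
    <-irrefl refl (≤-<-trans (proj₂ (encode-bounds c r z∈r)) (proj₁ (encode-bounds (c + size r) l z∈l)))

module EncodedNode (c : ℕ) (l r : Tree) where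
  private
    α β : List ℕ
    α = encode (c + size r) l
    β = encode c r
    M : ℕ
    M = c + size (node l r)
    α<M : ∀ i → i < length α → at α i < M
    α<M i i<a = below-root-left c l r (proj₂ (encode-bounds (c + size r) l (at-∈ α i<a)))
    β<M : ∀ k → k < length β → at β k < M
    β<M k k<b = below-root-right c l r (proj₂ (encode-bounds c r (at-∈ β k<b)))
    β<α : ∀ i k → i < length α → k < length β → at β k < at α i
    β<α i k i<a k<b = ≤-<-trans (proj₂ (encode-bounds c r (at-∈ β k<b)))
                                (proj₁ (encode-bounds (c + size r) l (at-∈ α i<a)))
  open Concat.Layered α β M α<M β<M β<α public

encode-avoids132 : ∀ c t → ¬ Contains132 (encode c t)
encode-avoids132 c leaf (occurrence _ _ _ _ _ () _ _)
encode-avoids132 c (node l r) = EncodedNode.avoids c l r (encode-avoids132 (c + size r) l) (encode-avoids132 c r)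

mmp0010-encode : ∀ c t → mmp0010 (encode c t) ≡ stat0010 t
mmp0010-encode c leaf       = refl
mmp0010-encode c (node l r) = begin
  mmp0010 (encode c (node l r))
    ≡⟨ EncodedNode.mmp0010-layered c l r ⟩
  mmp0010 (encode (c + size r) l) + (sgn (length (encode (c + size r) l)) + mmp0010 (encode c r))
    ≡⟨ cong₂ (λ x y → x + (sgn y + mmp0010 (encode c r))) (mmp0010-encode (c + size r) l) (length-encode (c + size r) l) ⟩
  stat0010 l + (sgn (size l) + mmp0010 (encode c r))
    ≡⟨ cong (λ x → stat0010 l + (sgn (size l) + x)) (mmp0010-encode c r) ⟩
  stat0010 (node l r) ∎
  where open ≡-Reasoning

mmp1000-encode : ∀ c t → mmp1000 (encode c t) ≡ stat1000 t
mmp1000-encode c leaf       = refl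
mmp1000-encode c (node l r) = begin
  mmp1000 (encode c (node l r))
    ≡⟨ EncodedNode.mmp1000-layered c l r ⟩
  (length (encode (c + size r) l) ∸ mmp0010 (encode (c + size r) l)) + mmp1000 (encode c r)
    ≡⟨ cong₂ (λ x y → (x ∸ y) + mmp1000 (encode c r)) (length-encode (c + size r) l) (mmp0010-encode (c + size r) l) ⟩
  (size l ∸ stat0010 l) + mmp1000 (encode c r)
    ≡⟨ cong ((size l ∸ stat0010 l) +_) (mmp1000-encode c r) ⟩
  stat1000 (node l r) ∎
  where open ≡-Reasoning

record IntervalPerm (c : ℕ) (w : List ℕ) : Set where
  field
    distinct : Unique w
    bounded  : ∀ {x} → x ∈ w → c < x × x ≤ c + length w
    covering : ∀ {x} → c < x → x ≤ c + length w → x ∈ w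

interval : ℕ → ℕ → List ℕ
interval c m = applyUpTo (λ i → suc (c + i)) m

length-interval : ∀ c m → length (interval c m) ≡ m
length-interval c m = length-applyUpTo _ m

interval-unique : ∀ c m → Unique (interval c m)
interval-unique c m = applyUpTo⁺₁ _ m (λ i<j _ e → <⇒≢ i<j (+-cancelˡ-≡ c _ _ (suc-injective e)))

∈-interval⁻ : ∀ c m {x} → x ∈ interval c m → c < x × x ≤ c + m
∈-interval⁻ c m x∈ with i , i<m , refl ← ∈-applyUpTo⁻ _ x∈ =
  s≤s (m≤m+n c i) , subst (_≤ c + m) (+-suc c i) (+-monoʳ-≤ c i<m)

∈-interval⁺ : ∀ c m {x} → c < x → x ≤ c + m → x ∈ interval c m
∈-interval⁺ c m c<x x≤ with d , refl ← m≤n⇒∃[o]m+o≡n c<x =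
  ∈-applyUpTo⁺ _ (+-cancelˡ-< c d m x≤)

downClosed⇒intervalPerm : ∀ c {β} → Unique β → (∀ {y} → y ∈ β → c < y) →
  (∀ {x y} → y ∈ β → c < x → x < y → x ∈ β) → IntervalPerm c β
downClosed⇒intervalPerm c {β} uβ above closed = record
  { distinct = uβ ; bounded = λ y∈ → above y∈ , bounded y∈ ; covering = covering }
  where
  -- if y = c + d ∈ β then c+1, …, c+d all lie in β, so d ≤ |β|
  bounded : ∀ {y} → y ∈ β → y ≤ c + length β
  bounded {y} y∈ with d , refl ← m≤n⇒∃[o]m+o≡n (<⇒≤ (above y∈)) =
    +-monoʳ-≤ c (subst (_≤ length β) (length-interval c d) (unique-⊆⇒length≤ (interval-unique c d) below-y))
    where
    below-y : interval c d ⊆ β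
    below-y x∈ with ∈-interval⁻ c d x∈
    ... | c<x , x≤y with m≤n⇒m<n∨m≡n x≤y
    ...   | inj₁ x<y  = closed y∈ c<x x<y
    ...   | inj₂ refl = y∈
  -- if x = c+1+d ∉ β, then β lies inside c+1, …, c+d, so |β| ≤ d
  covering : ∀ {x} → c < x → x ≤ c + length β → x ∈ β
  covering {x} c<x x≤ with x ∈? β
  ... | yes x∈ = x∈
  ... | no  x∉ with d , refl ← m≤n⇒∃[o]m+o≡n c<x =
    ⊥-elim (<⇒≱ (+-cancelˡ-< c d (length β) x≤)
      (subst (length β ≤_) (length-interval c d) (unique-⊆⇒length≤ uβ inside)))
    where
    inside : β ⊆ interval c d
    inside {y} y∈ with y ≤? c + d
    ... | yes y≤ = ∈-interval⁺ c d (above y∈) y≤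
    ... | no  y≰ with m≤n⇒m<n∨m≡n (≰⇒> y≰)
    ...   | inj₁ x<y  = ⊥-elim (x∉ (closed y∈ c<x x<y))
    ...   | inj₂ refl = ⊥-elim (x∉ y∈)

-- If w = α ++ M ∷ β is a 132-avoiding permutation of c+1, …, c+|w| and M = c+|w| is its
-- maximum, then β is a permutation of c+1, …, c+|β| and α one of the next |α| values:
-- an entry of α below an entry of β would form a 132 with M.
module SplitAtMaximum (c : ℕ) (α β : List ℕ) (M : ℕ) (M≡max : M ≡ c + length (α ++ M ∷ β))
                      (ip : IntervalPerm c (α ++ M ∷ β)) (avoid : ¬ Contains132 (α ++ M ∷ β)) where
  open IntervalPerm ip
  open Concat α β M using (w; length-w; contains132-left; contains132-right; contains132-across)

  private
    a k : ℕ
    a = length α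
    k = length β

    parts : Unique α × Unique (M ∷ β) × (∀ {z} → z ∈ α → z ∉ M ∷ β)
    parts = unique-++⁻ α distinct

    unique-α : Unique α
    unique-α = proj₁ parts

    unique-Mβ : Unique (M ∷ β)
    unique-Mβ = proj₁ (proj₂ parts)

    unique-β : Unique β
    unique-β with _ ∷ u ← unique-Mβ = u

    α∩β : ∀ {z} → z ∈ α → z ∉ β
    α∩β z∈ = proj₂ (proj₂ parts) z∈ ∘ there

    M∉β : M ∉ β
    M∉β = Unique[x∷xs]⇒x∉xs unique-Mβ

    in-α : ∀ {z} → z ∈ α → z ∈ w
    in-α = ∈-++⁺ˡ

    in-β : ∀ {z} → z ∈ β → z ∈ w
    in-β = ∈-++⁺ʳ α ∘ there

    ≤M : ∀ {z} → z ∈ w → z ≤ M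
    ≤M z∈ = subst (_ ≤_) (sym M≡max) (proj₂ (bounded z∈))

    in-w : ∀ {x} → c < x → x < M → x ∈ w
    in-w c<x x<M = covering c<x (subst (_ ≤_) M≡max (<⇒≤ x<M))

    β<M : ∀ {y} → y ∈ β → y < M
    β<M y∈ = ≤∧≢⇒< (≤M (in-β y∈)) (λ { refl → M∉β y∈ })

    α≮β : ∀ {z y} → z ∈ α → y ∈ β → z < y → ⊥
    α≮β {z} {y} z∈ y∈ z<y with i , i<a , refl ← ∈⇒at α z∈ | j , j<k , refl ← ∈⇒at β y∈ =
      avoid (contains132-across i j i<a j<k z<y (β<M y∈))

    β-closed : ∀ {x y} → y ∈ β → c < x → x < y → x ∈ β
    β-closed {x} y∈ c<x x<y with ∈-++⁻ α (in-w c<x (<-trans x<y (β<M y∈)))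
    ... | inj₁ x∈α        = ⊥-elim (α≮β x∈α y∈ x<y)
    ... | inj₂ (here refl) = ⊥-elim (<-asym x<y (β<M y∈))
    ... | inj₂ (there x∈β) = x∈β

    M≡ : M ≡ suc (c + k + a)
    M≡ = trans M≡max (trans (cong (c +_) length-w) (rearrange c k a))
      where
      rearrange : ∀ c k a → c + (a + suc k) ≡ suc (c + k + a)
      rearrange = solve-∀

  M∉α : M ∉ α
  M∉α M∈ = proj₂ (proj₂ parts) M∈ (here refl)

  avoid-α : ¬ Contains132 α
  avoid-α = avoid ∘ contains132-left

  avoid-β : ¬ Contains132 β
  avoid-β = avoid ∘ contains132-right

  interval-β : IntervalPerm c β
  interval-β = downClosed⇒intervalPerm c unique-β (λ y∈ → proj₁ (bounded (in-β y∈))) β-closed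

  interval-α : IntervalPerm (c + k) α
  interval-α = record { distinct = unique-α ; bounded = α-bounded ; covering = α-covering }
    where
    α-bounded : ∀ {z} → z ∈ α → c + k < z × z ≤ c + k + a
    α-bounded {z} z∈ with z ≤? c + k
    ... | yes z≤ = ⊥-elim (α∩β z∈ (IntervalPerm.covering interval-β (proj₁ (bounded (in-α z∈))) z≤))
    ... | no  z≰ = ≰⇒> z≰ , ≤-pred (subst (z <_) M≡ (≤∧≢⇒< (≤M (in-α z∈)) (λ { refl → M∉α z∈ })))
    α-covering : ∀ {x} → c + k < x → x ≤ c + k + a → x ∈ α
    α-covering {x} ck<x x≤ = locate (∈-++⁻ α (in-w (≤-<-trans (m≤m+n c k) ck<x) x<M))
      where
      x<M : x < M
      x<M = subst (x <_) (sym M≡) (s≤s x≤)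
      locate : x ∈ α ⊎ x ∈ M ∷ β → x ∈ α
      locate (inj₁ x∈α)         = x∈α
      locate (inj₂ (here refl))  = ⊥-elim (<-irrefl refl x<M)
      locate (inj₂ (there x∈β)) = ⊥-elim (<⇒≱ ck<x (proj₂ (IntervalPerm.bounded interval-β x∈β)))

-- Decoding a 132-avoiding permutation into a tree.

splitOn : ℕ → List ℕ → List ℕ × List ℕ
splitOn m []       = [] , []
splitOn m (x ∷ xs) with x ≟ m
... | yes _ = [] , xs
... | no  _ = x ∷ proj₁ (splitOn m xs) , proj₂ (splitOn m xs)

splitOn-++ : ∀ {m} α β → m ∉ α → splitOn m (α ++ m ∷ β) ≡ (α , β)
splitOn-++ {m} [] β _ with m ≟ m
... | yes _   = refl
... | no  m≢m = ⊥-elim (m≢m refl)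
splitOn-++ {m} (x ∷ α) β m∉ with x ≟ m
... | yes refl = ⊥-elim (m∉ (here refl))
... | no  _    = cong (λ p → x ∷ proj₁ p , proj₂ p) (splitOn-++ α β (m∉ ∘ there))

-- The inverse of encode: split at the maximum c + |w| and decode both sides.
-- The first argument is fuel, an upper bound on the length of w.
decodeWithin : ℕ → ℕ → List ℕ → Tree
decodeWithin zero    c _           = leaf
decodeWithin (suc f) c []          = leaf
decodeWithin (suc f) c w@(_ ∷ _) = node (decodeWithin f (c + length β) α) (decodeWithin f c β)
  where
  α = proj₁ (splitOn (c + length w) w)
  β = proj₂ (splitOn (c + length w) w)

decode : List ℕ → Tree
decode σ = decodeWithin (length σ) 0 σ

decode-++ : ∀ f c α M β → M ≡ c + length (α ++ M ∷ β) → M ∉ α →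
  decodeWithin (suc f) c (α ++ M ∷ β) ≡ node (decodeWithin f (c + length β) α) (decodeWithin f c β)
decode-++ f c α M β M≡ M∉α =
  trans (unfold α) (cong (λ p → node (decodeWithin f (c + length (proj₂ p)) (proj₁ p)) (decodeWithin f c (proj₂ p)))
                         (trans (cong (λ m → splitOn m (α ++ M ∷ β)) (sym M≡)) (splitOn-++ α β M∉α)))
  where
  unfold : ∀ α → decodeWithin (suc f) c (α ++ M ∷ β) ≡
    node (decodeWithin f (c + length (proj₂ (splitOn (c + length (α ++ M ∷ β)) (α ++ M ∷ β))))
                         (proj₁ (splitOn (c + length (α ++ M ∷ β)) (α ++ M ∷ β))))
         (decodeWithin f c (proj₂ (splitOn (c + length (α ++ M ∷ β)) (α ++ M ∷ β))))
  unfold []      = refl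
  unfold (_ ∷ _) = refl

decodeWithin-encode : ∀ f c t → size t ≤ f → decodeWithin f c (encode c t) ≡ t
decodeWithin-encode zero    c leaf       _         = refl
decodeWithin-encode (suc f) c leaf       _         = refl
decodeWithin-encode (suc f) c (node l r) (s≤s l+r≤f) = begin
  decodeWithin (suc f) c (encode c (node l r))
    ≡⟨ decode-++ f c (encode (c + size r) l) M (encode c r) (cong (c +_) (sym (length-encode c (node l r)))) M∉l ⟩
  node (decodeWithin f (c + length (encode c r)) (encode (c + size r) l)) (decodeWithin f c (encode c r))
    ≡⟨ cong (λ n → node (decodeWithin f (c + n) (encode (c + size r) l)) (decodeWithin f c (encode c r))) (length-encode c r) ⟩
  node (decodeWithin f (c + size r) (encode (c + size r) l)) (decodeWithin f c (encode c r))
    ≡⟨ cong₂ node (decodeWithin-encode f (c + size r) l (≤-trans (m≤m+n (size l) (size r)) l+r≤f))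
                  (decodeWithin-encode f c r (≤-trans (m≤n+m (size r) (size l)) l+r≤f)) ⟩
  node l r ∎
  where
  open ≡-Reasoning
  M : ℕ
  M = c + size (node l r)
  M∉l : M ∉ encode (c + size r) l
  M∉l M∈ = <-irrefl refl (below-root-left c l r (proj₂ (encode-bounds (c + size r) l M∈)))

decode-encode : ∀ t → decode (encode 0 t) ≡ t
decode-encode t = decodeWithin-encode (length (encode 0 t)) 0 t (≤-reflexive (sym (length-encode 0 t)))

encode-node : ∀ {c k a tα tβ α β M} → size tβ ≡ k → size tα ≡ a → encode (c + k) tα ≡ α →
  encode c tβ ≡ β → M ≡ c + suc (a + k) → encode c (node tα tβ) ≡ α ++ M ∷ β
encode-node refl refl refl refl refl = refl

encode-decode-step : ∀ f c α M β → M ≡ c + length (α ++ M ∷ β) →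
  IntervalPerm c (α ++ M ∷ β) → ¬ Contains132 (α ++ M ∷ β) → length (α ++ M ∷ β) ≤ suc f →
  (∀ c′ v → IntervalPerm c′ v → ¬ Contains132 v → length v ≤ f → encode c′ (decodeWithin f c′ v) ≡ v) →
  encode c (decodeWithin (suc f) c (α ++ M ∷ β)) ≡ α ++ M ∷ β
encode-decode-step f c α M β M≡max ip avoid len IH = begin
  encode c (decodeWithin (suc f) c (α ++ M ∷ β))
    ≡⟨ cong (encode c) (decode-++ f c α M β M≡max M∉α) ⟩
  encode c (node (decodeWithin f (c + k) α) (decodeWithin f c β))
    ≡⟨ encode-node {tα = decodeWithin f (c + k) α} {tβ = decodeWithin f c β}
                   (size-from encode-β) (size-from encode-α) encode-α encode-β
                   (trans M≡max (cong (c +_) (trans length-w (+-suc a k)))) ⟩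
  α ++ M ∷ β ∎
  where
  open ≡-Reasoning
  open Concat α β M using (a; length-w) renaming (b to k)
  open SplitAtMaximum c α β M M≡max ip avoid
  a+k≤f : a + k ≤ f
  a+k≤f = ≤-pred (subst (_≤ suc f) (trans length-w (+-suc a k)) len)
  encode-α : encode (c + k) (decodeWithin f (c + k) α) ≡ α
  encode-α = IH (c + k) α interval-α avoid-α (≤-trans (m≤m+n a k) a+k≤f)
  encode-β : encode c (decodeWithin f c β) ≡ β
  encode-β = IH c β interval-β avoid-β (≤-trans (m≤n+m k a) a+k≤f)
  size-from : ∀ {c′ t v} → encode c′ t ≡ v → size t ≡ length v
  size-from {c′} {t} e = trans (sym (length-encode c′ t)) (cong length e)

encode-decodeWithin : ∀ f c w → IntervalPerm c w → ¬ Contains132 w → length w ≤ f →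
  encode c (decodeWithin f c w) ≡ w
encode-decodeWithin zero    c []       _  _     _ = refl
encode-decodeWithin (suc f) c []       _  _     _ = refl
encode-decodeWithin (suc f) c w@(x ∷ xs) ip avoid len
  with α , β , w≡ ← ∈-∃++ (IntervalPerm.covering ip (a<a+suc c (length xs)) (≤-refl {c + length w})) =
  subst (λ v → encode c (decodeWithin (suc f) c v) ≡ v) (sym w≡)
    (encode-decode-step f c α (c + length w) β (cong (λ v → c + length v) w≡)
      (subst (IntervalPerm c) w≡ ip) (subst (¬_ ∘ Contains132) w≡ avoid) (subst (λ v → length v ≤ suc f) w≡ len)
      (encode-decodeWithin f))

alphabet : ∀ n → map suc (upTo n) ≡ interval 0 n
alphabet n = map-upTo suc n

words-suc : ∀ n k → words n (suc k) ≡ cartesianProductWith _∷_ (map suc (upTo n)) (words n k)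
words-suc n k = prepend (map suc (upTo n))
  where
  prepend : ∀ L → concatMap (λ x → map (x ∷_) (words n k)) L ≡ cartesianProductWith _∷_ L (words n k)
  prepend []      = refl
  prepend (x ∷ L) = cong (map (x ∷_) (words n k) ++_) (prepend L)

∷-injective : ∀ {x y : ℕ} {xs ys} → x ∷ xs ≡ y ∷ ys → x ≡ y × xs ≡ ys
∷-injective refl = refl , refl

words-unique : ∀ n k → Unique (words n k)
words-unique n zero    = [] ∷ []
words-unique n (suc k) = subst Unique (sym (words-suc n k))
  (cartesianProductWith⁺ _∷_ ∷-injective (subst Unique (sym (alphabet n)) (interval-unique 0 n)) (words-unique n k))

∈-words⁻ : ∀ n k {w} → w ∈ words n k → length w ≡ k × (∀ {x} → x ∈ w → 0 < x × x ≤ n)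
∈-words⁻ n zero (here refl) = refl , λ ()
∈-words⁻ n (suc k) w∈
  with x , v , x∈ , v∈ , refl ← ∈-cartesianProductWith⁻ _∷_ (map suc (upTo n)) (words n k) (subst (_ ∈_) (words-suc n k) w∈)
  with len , letters ← ∈-words⁻ n k v∈ =
  cong suc len , λ { (here refl) → ∈-interval⁻ 0 n (subst (_ ∈_) (alphabet n) x∈) ; (there y∈) → letters y∈ }

∈-words⁺ : ∀ n k {w} → length w ≡ k → (∀ {x} → x ∈ w → 0 < x × x ≤ n) → w ∈ words n k
∈-words⁺ n zero    {[]}    _   _       = here refl
∈-words⁺ n (suc k) {x ∷ w} len letters = subst (_ ∈_) (sym (words-suc n k))
  (∈-cartesianProductWith⁺ _∷_ (subst (x ∈_) (sym (alphabet n)) (uncurry (∈-interval⁺ 0 n) (letters (here refl))))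
                              (∈-words⁺ n k (suc-injective len) (letters ∘ there)))

isPerm⇒ : ∀ n w → T (isPerm n w) → interval 0 n ⊆ w
isPerm⇒ n w t {v} v∈
  with x , x∈ , x≡v ← find (any⁻ _ w (All.lookup (AllProps.all⁺ _ _ t) (subst (v ∈_) (sym (alphabet n)) v∈))) =
  subst (_∈ w) (≡ᵇ⇒≡ x v x≡v) x∈

isPerm⇐ : ∀ n w → interval 0 n ⊆ w → T (isPerm n w)
isPerm⇐ n w sub = AllProps.all⁻ _ (All.tabulate λ {v} v∈ →
  any⁺ _ (lose (sub (subst (v ∈_) (alphabet n) v∈)) (≡⇒≡ᵇ v v refl)))

∈-Sym132⁻ : ∀ n {σ} → σ ∈ Sym132 n → IntervalPerm 0 σ × length σ ≡ n × ¬ Contains132 σ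
∈-Sym132⁻ n {σ} σ∈
  with σ∈′ , avoid ← ∈-filter⁻ (T? ∘ avoids132) σ∈
  with σ∈w , perm ← ∈-filter⁻ (T? ∘ isPerm n) σ∈′
  with len , letters ← ∈-words⁻ n n σ∈w =
  ip , len , avoids132⇒ σ avoid
  where
  cover : interval 0 n ⊆ σ
  cover = isPerm⇒ n σ perm
  ip : IntervalPerm 0 σ
  ip = record
    { distinct = proj₁ (covering-unique (interval-unique 0 n) cover
                          (subst (length σ ≤_) (sym (length-interval 0 n)) (≤-reflexive len)))
    ; bounded  = λ x∈ → subst (λ m → 0 < _ × _ ≤ m) (sym len) (letters x∈)
    ; covering = λ 0<x x≤ → cover (∈-interval⁺ 0 n 0<x (subst (_ ≤_) len x≤))
    }

∈-Sym132⁺ : ∀ n {σ} → IntervalPerm 0 σ → length σ ≡ n → ¬ Contains132 σ → σ ∈ Sym132 n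
∈-Sym132⁺ n {σ} ip len avoid =
  ∈-filter⁺ (T? ∘ avoids132)
    (∈-filter⁺ (T? ∘ isPerm n)
      (∈-words⁺ n n len (λ x∈ → subst (λ m → 0 < _ × _ ≤ m) len (IntervalPerm.bounded ip x∈)))
      (isPerm⇐ n σ (λ v∈ → let (0<v , v≤n) = ∈-interval⁻ 0 n v∈ in
                            IntervalPerm.covering ip 0<v (subst (_ ≤_) (sym len) v≤n))))
    (avoids132⇐ σ avoid)

Sym132-unique : ∀ n → Unique (Sym132 n)
Sym132-unique n = filter⁺ (T? ∘ avoids132) (filter⁺ (T? ∘ isPerm n) (words-unique n n))

-- The involution on S_n(132) exchanging the two statistics.

encode-intervalPerm : ∀ c t → IntervalPerm c (encode c t)
encode-intervalPerm c t = record
  { distinct = encode-unique c t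
  ; bounded  = λ x∈ → subst (λ m → c < _ × _ ≤ c + m) (sym (length-encode c t)) (encode-bounds c t x∈)
  ; covering = λ c<x x≤ → encode-covers c t c<x (subst (λ m → _ ≤ c + m) (length-encode c t) x≤)
  }

encode-∈-Sym132 : ∀ n t → size t ≡ n → encode 0 t ∈ Sym132 n
encode-∈-Sym132 n t size≡n = ∈-Sym132⁺ n (encode-intervalPerm 0 t) (trans (length-encode 0 t) size≡n) (encode-avoids132 0 t)

encode-decode : ∀ n {σ} → σ ∈ Sym132 n → encode 0 (decode σ) ≡ σ
encode-decode n {σ} σ∈ with ip , _ , avoid ← ∈-Sym132⁻ n σ∈ = encode-decodeWithin (length σ) 0 σ ip avoid ≤-refl

size-decode : ∀ n {σ} → σ ∈ Sym132 n → size (decode σ) ≡ n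
size-decode n {σ} σ∈ =
  trans (sym (length-encode 0 (decode σ))) (trans (cong length (encode-decode n σ∈)) (proj₁ (proj₂ (∈-Sym132⁻ n σ∈))))

Φ : List ℕ → List ℕ
Φ σ = encode 0 (twist (decode σ))

Φ-closed : ∀ n {σ} → σ ∈ Sym132 n → Φ σ ∈ Sym132 n
Φ-closed n {σ} σ∈ = encode-∈-Sym132 n (twist (decode σ)) (trans (size-twist (decode σ)) (size-decode n σ∈))

Φ-involutive : ∀ n {σ} → σ ∈ Sym132 n → Φ (Φ σ) ≡ σ
Φ-involutive n {σ} σ∈ = begin
  encode 0 (twist (decode (encode 0 (twist (decode σ))))) ≡⟨ cong (encode 0 ∘ twist) (decode-encode (twist (decode σ))) ⟩
  encode 0 (twist (twist (decode σ)))                     ≡⟨ cong (encode 0) (twist-involutive (decode σ)) ⟩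
  encode 0 (decode σ)                                     ≡⟨ encode-decode n σ∈ ⟩
  σ                                                       ∎
  where open ≡-Reasoning

mmp1000-Φ : ∀ n {σ} → σ ∈ Sym132 n → mmp1000 (Φ σ) ≡ mmp0010 σ
mmp1000-Φ n {σ} σ∈ = begin
  mmp1000 (encode 0 (twist (decode σ))) ≡⟨ mmp1000-encode 0 (twist (decode σ)) ⟩
  stat1000 (twist (decode σ))           ≡⟨ stat1000-twist (decode σ) ⟩
  stat0010 (decode σ)                   ≡⟨ sym (mmp0010-encode 0 (decode σ)) ⟩
  mmp0010 (encode 0 (decode σ))         ≡⟨ cong mmp0010 (encode-decode n σ∈) ⟩
  mmp0010 σ                             ∎
  where open ≡-Reasoning

mmp0010-Φ : ∀ n {σ} → σ ∈ Sym132 n → mmp0010 (Φ σ) ≡ mmp1000 σ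
mmp0010-Φ n {σ} σ∈ = begin
  mmp0010 (encode 0 (twist (decode σ))) ≡⟨ mmp0010-encode 0 (twist (decode σ)) ⟩
  stat0010 (twist (decode σ))           ≡⟨ stat0010-twist (decode σ) ⟩
  stat1000 (decode σ)                   ≡⟨ sym (mmp1000-encode 0 (decode σ)) ⟩
  mmp1000 (encode 0 (decode σ))         ≡⟨ cong mmp1000 (encode-decode n σ∈) ⟩
  mmp1000 σ                             ∎
  where open ≡-Reasoning

theorem26 : (n : ℕ) → n ≥ 1 → (p q : ℕ) →
    count (λ σ → (mmp1000 σ ≡ᵇ p) ∧ (mmp0010 σ ≡ᵇ q)) (Sym132 n)
      ≡ count (λ σ → (mmp0010 σ ≡ᵇ p) ∧ (mmp1000 σ ≡ᵇ q)) (Sym132 n)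
theorem26 n _ p q = begin
  count joint (Sym132 n)       ≡⟨ count-involution joint Φ (Sym132-unique n) (Φ-closed n) (Φ-involutive n) ⟩
  count (joint ∘ Φ) (Sym132 n) ≡⟨ count-cong (joint ∘ Φ) swapped (λ σ∈ → cong₂ (λ x y → (x ≡ᵇ p) ∧ (y ≡ᵇ q))
                                                                    (mmp1000-Φ n σ∈) (mmp0010-Φ n σ∈)) ⟩
  count swapped (Sym132 n)     ∎
  where
  open ≡-Reasoning
  joint swapped : List ℕ → Bool
  joint   σ = (mmp1000 σ ≡ᵇ p) ∧ (mmp0010 σ ≡ᵇ q)
  swapped σ = (mmp0010 σ ≡ᵇ p) ∧ (mmp1000 σ ≡ᵇ q)
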